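{- Let $k\ge 2$, let $\Gamma=\binom{k}{2}m^{1/\lfloor k/2\rfloor}$ and let $G$ be a $k$-uniform hypergraph with $m$ edges. Then there exist an ordering $e^1,\dots,e^m$ of the edges of $G$ and vertices $u^i,v^i\in e^i$ with $u^i\ne v^i$ such that for each $1\le i\le m-1$, the number of $j>i$ for which $e^j\supseteq e^i\setminus\{u^i,v^i\}$ is at most $\Gamma$. -}

module Defs where

open import Data.Nat using (ℕ)
open import Data.Bool using (_∧_)
open import Data.Fin using (Fin; _<_)
open import Data.Fin.Properties using (_<?_)
open import Data.Fin.Subset using (Subset; _-_; _⊆_; ∣_∣)
open import Data.Fin.Subset.Properties using (_⊆?_)
open import Data.Vec using (tabulate)
open import Relation.Nullary.Decidable using (⌊_⌋)

laterCount : {m n : ℕ} → (Fin m → Subset n) → (Fin m → Fin n) → (Fin m → Fin n) → Fin m → ℕ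
laterCount {m} e u v i =
  ∣ tabulate (λ j → ⌊ i <? j ⌋ ∧ ⌊ ((e i - u i) - v i) ⊆? e j ⌋) ∣

{-# OPTIONS --safe #-}
module Submission where

-- Order the edges greedily: choose an edge e and distinct u, v ∈ e minimising the
-- codegree Γ = #{edges ⊇ e ∖ {u, v}}, put e first and recurse on the remaining edges.
-- The edges j > i counted at position i all contain eⁱ ∖ {uⁱ, vⁱ}, so it suffices
-- to show Γ ^ ⌊k/2⌋ ≤ (k C 2) ^ ⌊k/2⌋ · m. Writing deg S for the number of edges
-- containing S, double counting gives Γ · deg S ≤ (k C 2) · deg (S ∖ {a, b}) for
-- a ≠ b in S: every edge f ⊇ S has deg (f ∖ {a, b}) ≥ Γ by minimality, while an edge
-- g ⊇ S ∖ {a, b} contains at most k C 2 of the distinct (k-2)-sets f ∖ {a, b}.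
-- Starting from S = e (deg e ≥ 1) and deleting ⌊k/2⌋ pairs ends with deg S ≤ m.

open import Defs
open import Data.Bool using (Bool; true; false; T; not; _∧_)
open import Data.Bool.Properties using (T-∧; T-≡; T-not-≡)
open import Data.Fin using (Fin; zero; suc; punchIn; punchOut)
open import Data.Fin.Properties as Finₚ
  using (_<?_; punchIn-punchOut; punchOut-injective; punchIn-injective; punchInᵢ≢i)
open import Data.Fin.Subset
  using (Subset; inside; outside; _∈_; _∉_; _⊆_; _-_; _─_; ∣_∣; Nonempty)
open import Data.Fin.Subset.Properties
  using (_⊆?_; _∈?_; ⊆-refl; ⊆-reflexive; ⊆-antisym; drop-∷-⊆; p─q⊆p; p─⊥≡p; x∈p∧x≢y⇒x∈p-y)
open import Data.Nat using (ℕ; zero; suc; _+_; _*_; _^_; _/_; _≤_; _<_; z≤n; s≤s; s≤s⁻¹; s<s; s<s⁻¹)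
open import Data.Nat.Combinatorics using (_C_; nCk+nC[k+1]≡[n+1]C[k+1])
open import Data.Nat.DivMod using (m/n*n≤m)
open import Data.Nat.Properties as ℕ hiding (_<?_)
open import Algebra.Properties.CommutativeSemigroup ℕ.*-commutativeSemigroup
  using (xy∙z≈y∙xz; x∙yz≈y∙xz)
open import Algebra.Properties.Semiring.Sum ℕ.+-*-semiring
  using (sum; sum-syntax; sum-remove; sum-cong-≗; ∑-distrib-+; ∑-comm; *-distribˡ-sum; *-distribʳ-sum)
open import Data.Product using (Σ; ∃; ∃₂; _×_; _,_; proj₁; proj₂; uncurry)
import Data.Product as Product
open import Data.Vec using ([]; _∷_; here; there; head; tail; tabulate)
import Data.Vec.Functional as Vector
open import Function using (_∘_; Equivalence; mk⇔)
open import Function.Definitions using (Injective)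
open import Relation.Binary.PropositionalEquality
open import Relation.Nullary using (Dec; yes; no; ¬_; ¬?; map′; contradiction)
open import Relation.Nullary.Decidable
  using (⌊_⌋; _×-dec_; toWitness; fromWitness; does-⇔; isYes≗does)

-- Counting

𝟙 : Bool → ℕ
𝟙 true  = 1
𝟙 false = 0

count : ∀ {m} → (Fin m → Bool) → ℕ
count {m} p = ∑[ i < m ] 𝟙 (p i)

𝟙-∧ : ∀ a b → 𝟙 a * 𝟙 b ≡ 𝟙 (a ∧ b)
𝟙-∧ true  true  = refl
𝟙-∧ true  false = refl
𝟙-∧ false _     = refl

𝟙-*-mono-≤ : ∀ b {x y} → (T b → x ≤ y) → 𝟙 b * x ≤ 𝟙 b * y
𝟙-*-mono-≤ true  x≤y = *-monoʳ-≤ 1 (x≤y _)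
𝟙-*-mono-≤ false _   = z≤n

toWitness-∧ : ∀ {p q} {P : Set p} {Q : Set q} {P? : Dec P} {Q? : Dec Q} →
              T (⌊ P? ⌋ ∧ ⌊ Q? ⌋) → P × Q
toWitness-∧ {P? = P?} {Q?} PQ =
  let P , Q = Equivalence.to (T-∧ {⌊ P? ⌋} {⌊ Q? ⌋}) PQ in toWitness P , toWitness Q

∑-mono-≤ : ∀ {m} {f g : Fin m → ℕ} → (∀ i → f i ≤ g i) → sum f ≤ sum g
∑-mono-≤ {zero}  f≤g = z≤n
∑-mono-≤ {suc m} f≤g = +-mono-≤ (f≤g zero) (∑-mono-≤ (f≤g ∘ suc))

∑-injective-≤ : ∀ {a b} (f : Fin b → ℕ) {τ : Fin a → Fin b} → Injective _≡_ _≡_ τ →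
                ∑[ i < a ] f (τ i) ≤ sum f
∑-injective-≤ {zero}          f τ-injective = z≤n
∑-injective-≤ {suc a} {zero}  f {τ} τ-injective with τ zero
... | ()
∑-injective-≤ {suc a} {suc b} f {τ} τ-injective = begin
  f (τ zero) + ∑[ i < a ] f (τ (suc i))
    ≡⟨ cong (f (τ zero) +_) (sum-cong-≗ (λ i → cong f (punchIn-punchOut (τ₀≢ i)))) ⟨
  f (τ zero) + ∑[ i < a ] f (punchIn (τ zero) (τ′ i))
    ≤⟨ +-monoʳ-≤ (f (τ zero)) (∑-injective-≤ (f ∘ punchIn (τ zero)) τ′-injective) ⟩
  f (τ zero) + ∑[ j < b ] f (punchIn (τ zero) j)
    ≡⟨ sum-remove f ⟨
  sum f ∎
  where
  open ≤-Reasoning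
  τ₀≢ : ∀ i → τ zero ≢ τ (suc i)
  τ₀≢ i = Finₚ.0≢1+n ∘ τ-injective
  τ′ : Fin a → Fin b
  τ′ i = punchOut (τ₀≢ i)
  τ′-injective : Injective _≡_ _≡_ τ′
  τ′-injective eq = Finₚ.suc-injective (τ-injective (punchOut-injective (τ₀≢ _) (τ₀≢ _) eq))

∣tabulate∣≡count : ∀ {m} (p : Fin m → Bool) → ∣ tabulate p ∣ ≡ count p
∣tabulate∣≡count {zero}  p = refl
∣tabulate∣≡count {suc m} p with p zero
... | true  = cong suc (∣tabulate∣≡count (p ∘ suc))
... | false = ∣tabulate∣≡count (p ∘ suc)

count-≤ : ∀ {m} (p : Fin m → Bool) → count p ≤ m
count-≤ {zero}  p = z≤n
count-≤ {suc m} p = +-mono-≤ (𝟙≤1 (p zero)) (count-≤ (p ∘ suc))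
  where
  𝟙≤1 : ∀ b → 𝟙 b ≤ 1
  𝟙≤1 true  = ≤-refl
  𝟙≤1 false = z≤n

1≤count : ∀ {m} {p : Fin m → Bool} i → T (p i) → 1 ≤ count p
1≤count {p = p} zero    pᵢ with p zero
... | true = s≤s z≤n
1≤count {p = p} (suc i) pᵢ = ≤-trans (1≤count {p = p ∘ suc} i pᵢ) (m≤n+m _ (𝟙 (p zero)))

count-≡-0 : ∀ {m} {p : Fin m → Bool} → (∀ i → ¬ T (p i)) → count p ≡ 0
count-≡-0 {zero}        none = refl
count-≡-0 {suc m} {p} none with p zero in p₀
... | true  = contradiction (Equivalence.from T-≡ p₀) (none zero)
... | false = count-≡-0 {p = p ∘ suc} (none ∘ suc)

count-≤-1 : ∀ {m} {p : Fin m → Bool} → (∀ {i j} → T (p i) → T (p j) → i ≡ j) → count p ≤ 1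
count-≤-1 {zero}        unique = z≤n
count-≤-1 {suc m} {p} unique with p zero in p₀
... | true  = ≤-reflexive (cong suc (count-≡-0 {p = p ∘ suc}
                (λ i pᵢ → Finₚ.0≢1+n (unique (Equivalence.from T-≡ p₀) pᵢ))))
... | false = count-≤-1 {p = p ∘ suc} (λ pᵢ pⱼ → Finₚ.suc-injective (unique pᵢ pⱼ))

count-split : ∀ {m} (p q : Fin m → Bool) →
              count p ≡ count (λ i → p i ∧ q i) + count (λ i → p i ∧ not (q i))
count-split p q = trans (sum-cong-≗ (λ i → 𝟙-split (p i) (q i)))
                        (∑-distrib-+ (λ i → 𝟙 (p i ∧ q i)) (λ i → 𝟙 (p i ∧ not (q i))))
  where
  𝟙-split : ∀ a b → 𝟙 a ≡ 𝟙 (a ∧ b) + 𝟙 (a ∧ not b)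
  𝟙-split true  true  = refl
  𝟙-split true  false = refl
  𝟙-split false _     = refl

-- Subsets

x∉p-x : ∀ {n} (p : Subset n) x → x ∉ p - x
x∉p-x (_ ∷ p) (suc x) (there x∈p-x) = x∉p-x p x x∈p-x

x∈p-y⁻ : ∀ {n} {p : Subset n} {x y} → x ∈ p - y → x ∈ p × x ≢ y
x∈p-y⁻ {p = p} {x} x∈p-y = p─q⊆p p _ x∈p-y , λ { refl → x∉p-x p x x∈p-y }

p⊆q⇒p-x⊆q-x : ∀ {n} {p q : Subset n} {x} → p ⊆ q → p - x ⊆ q - x
p⊆q⇒p-x⊆q-x p⊆q z∈p-x = let z∈p , z≢x = x∈p-y⁻ z∈p-x in x∈p∧x≢y⇒x∈p-y (p⊆q z∈p) z≢x

x∈p⇒1+∣p-x∣≡∣p∣ : ∀ {n} {p : Subset n} {x} → x ∈ p → suc ∣ p - x ∣ ≡ ∣ p ∣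
x∈p⇒1+∣p-x∣≡∣p∣ {p = inside  ∷ p} here        = cong (suc ∘ ∣_∣) (p─⊥≡p p)
x∈p⇒1+∣p-x∣≡∣p∣ {p = inside  ∷ p} (there x∈p) = cong suc (x∈p⇒1+∣p-x∣≡∣p∣ x∈p)
x∈p⇒1+∣p-x∣≡∣p∣ {p = outside ∷ p} (there x∈p) = x∈p⇒1+∣p-x∣≡∣p∣ x∈p

2+∣p-x-y∣≡∣p∣ : ∀ {n} {p : Subset n} {x y} → x ∈ p → y ∈ p → x ≢ y → 2 + ∣ p - x - y ∣ ≡ ∣ p ∣
2+∣p-x-y∣≡∣p∣ x∈p y∈p x≢y =
  trans (cong suc (x∈p⇒1+∣p-x∣≡∣p∣ (x∈p∧x≢y⇒x∈p-y y∈p (x≢y ∘ sym)))) (x∈p⇒1+∣p-x∣≡∣p∣ x∈p)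

∣p∣>0⇒nonempty : ∀ {n} (p : Subset n) → 0 < ∣ p ∣ → Nonempty p
∣p∣>0⇒nonempty (inside  ∷ p) _      = zero , here
∣p∣>0⇒nonempty (outside ∷ p) ∣p∣>0 = Product.map suc there (∣p∣>0⇒nonempty p ∣p∣>0)

∣p∣≥2⇒two-elements : ∀ {n} (p : Subset n) → 2 ≤ ∣ p ∣ → ∃₂ λ x y → x ∈ p × y ∈ p × x ≢ y
∣p∣≥2⇒two-elements p ∣p∣≥2
  with x , x∈p   ← ∣p∣>0⇒nonempty p (≤-trans (s≤s z≤n) ∣p∣≥2)
  with y , y∈p-x ← ∣p∣>0⇒nonempty (p - x) (s≤s⁻¹ (subst (2 ≤_) (sym (x∈p⇒1+∣p-x∣≡∣p∣ x∈p)) ∣p∣≥2))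
  with y∈p , y≢x ← x∈p-y⁻ y∈p-x
  = x , y , x∈p , y∈p , y≢x ∘ sym

p-x-y⊆q-x-y⇒p⊆q : ∀ {n} {p q : Subset n} {x y} → x ∈ q → y ∈ q → p - x - y ⊆ q - x - y → p ⊆ q
p-x-y⊆q-x-y⇒p⊆q {x = x} {y} x∈q y∈q p-x-y⊆q-x-y {z} z∈p with z Finₚ.≟ x | z Finₚ.≟ y
... | yes refl | _        = x∈q
... | no _     | yes refl = y∈q
... | no z≢x   | no z≢y   =
  proj₁ (x∈p-y⁻ (proj₁ (x∈p-y⁻ (p-x-y⊆q-x-y (x∈p∧x≢y⇒x∈p-y (x∈p∧x≢y⇒x∈p-y z∈p z≢x) z≢y)))))

p-x-y≡q-x-y⇒p≡q : ∀ {n} {p q : Subset n} {x y} → x ∈ p → y ∈ p → x ∈ q → y ∈ q →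
                  p - x - y ≡ q - x - y → p ≡ q
p-x-y≡q-x-y⇒p≡q x∈p y∈p x∈q y∈q eq =
  ⊆-antisym (p-x-y⊆q-x-y⇒p⊆q x∈q y∈q (⊆-reflexive eq)) (p-x-y⊆q-x-y⇒p⊆q x∈p y∈p (⊆-reflexive (sym eq)))

p⊆q⇒∣q─p∣+∣p∣≡∣q∣ : ∀ {n} {p q : Subset n} → p ⊆ q → ∣ q ─ p ∣ + ∣ p ∣ ≡ ∣ q ∣
p⊆q⇒∣q─p∣+∣p∣≡∣q∣ {p = []}          {[]}          _   = refl
p⊆q⇒∣q─p∣+∣p∣≡∣q∣ {p = inside  ∷ p} {inside  ∷ q} p⊆q =
  trans (+-suc _ _) (cong suc (p⊆q⇒∣q─p∣+∣p∣≡∣q∣ (drop-∷-⊆ p⊆q)))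
p⊆q⇒∣q─p∣+∣p∣≡∣q∣ {p = inside  ∷ p} {outside ∷ q} p⊆q = contradiction (p⊆q here) λ ()
p⊆q⇒∣q─p∣+∣p∣≡∣q∣ {p = outside ∷ p} {inside  ∷ q} p⊆q = cong suc (p⊆q⇒∣q─p∣+∣p∣≡∣q∣ (drop-∷-⊆ p⊆q))
p⊆q⇒∣q─p∣+∣p∣≡∣q∣ {p = outside ∷ p} {outside ∷ q} p⊆q = p⊆q⇒∣q─p∣+∣p∣≡∣q∣ (drop-∷-⊆ p⊆q)

head-tail⇒≡ : ∀ {n} {p q : Subset (suc n)} → head p ≡ head q → tail p ≡ tail q → p ≡ q
head-tail⇒≡ {p = _ ∷ _} {_ ∷ _} refl refl = refl

infix 4 _⊆[_]_
_⊆[_]_ : ∀ {n} → Subset n → ℕ → Subset n → Set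
p ⊆[ c ] q = p ⊆ q × ∣ q ─ p ∣ ≡ c

module _ {n} {q : Subset n} where

  head∈⇒tail-⊆[] : ∀ {b c} {p : Subset (suc n)} → T (head p) → p ⊆[ c ] b ∷ q → tail p ⊆[ c ] q
  head∈⇒tail-⊆[] {p = inside ∷ _} _ (p⊆ , refl) = drop-∷-⊆ p⊆ , refl

  head∉⇒tail-⊆[] : ∀ {c} {p : Subset (suc n)} → T (not (head p)) → p ⊆[ c ] outside ∷ q → tail p ⊆[ c ] q
  head∉⇒tail-⊆[] {p = outside ∷ _} _ (p⊆ , refl) = drop-∷-⊆ p⊆ , refl

  head∉⇒tail-⊆[pred] : ∀ {c} {p : Subset (suc n)} →
                       T (not (head p)) → p ⊆[ suc c ] inside ∷ q → tail p ⊆[ c ] q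
  head∉⇒tail-⊆[pred] {p = outside ∷ _} _ (p⊆ , refl) = drop-∷-⊆ p⊆ , refl

  head∈⇒⊈[]outside : ∀ {c} {p : Subset (suc n)} → T (head p) → ¬ (p ⊆[ c ] outside ∷ q)
  head∈⇒⊈[]outside {p = inside ∷ _} _ (p⊆ , _) = contradiction (p⊆ here) λ ()

  head∉⇒⊈[0]inside : ∀ {p : Subset (suc n)} → T (not (head p)) → ¬ (p ⊆[ 0 ] inside ∷ q)
  head∉⇒⊈[0]inside {p = outside ∷ _} _ (_ , ())

-- Pascal's rule, after splitting the family by whether its members contain the first point.
injective-family-≤-C : ∀ {m n} (q : Subset n) (c : ℕ) (A : Fin m → Bool) (φ : Fin m → Subset n) →
                       (∀ {f} → T (A f) → φ f ⊆[ c ] q) →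
                       (∀ {f g} → T (A f) → T (A g) → φ f ≡ φ g → f ≡ g) →
                       count A ≤ ∣ q ∣ C c
injective-family-≤-C [] zero A φ _ injective =
  count-≤-1 (λ Af Ag → injective Af Ag (Subset₀-unique _ _))
  where
  Subset₀-unique : (p p′ : Subset 0) → p ≡ p′
  Subset₀-unique [] [] = refl
injective-family-≤-C [] (suc c) A φ φ⊆ _ =
  ≤-reflexive (count-≡-0 {p = A} (λ f Af → ∣[]─p∣≢1+c (φ f) (proj₂ (φ⊆ Af))))
  where
  ∣[]─p∣≢1+c : ∀ (p : Subset 0) → ∣ [] ─ p ∣ ≢ suc c
  ∣[]─p∣≢1+c [] ()
injective-family-≤-C (b ∷ q) c A φ φ⊆ injective = begin
  count A              ≡⟨ count-split A (head ∘ φ) ⟩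
  count A₁ + count A₀  ≤⟨ split-≤ b c φ⊆₁ φ⊆₀ ⟩
  ∣ b ∷ q ∣ C c         ∎
  where
  open ≤-Reasoning
  A₁ A₀ : Fin _ → Bool
  A₁ f = A f ∧ head (φ f)
  A₀ f = A f ∧ not (head (φ f))
  split : ∀ {a h} → T (a ∧ h) → T a × T h
  split = Equivalence.to T-∧
  φ⊆₁ : ∀ {f} → T (A₁ f) → T (head (φ f)) × φ f ⊆[ c ] b ∷ q
  φ⊆₁ A₁f = let Af , hf = split A₁f in hf , φ⊆ Af
  φ⊆₀ : ∀ {f} → T (A₀ f) → T (not (head (φ f))) × φ f ⊆[ c ] b ∷ q
  φ⊆₀ A₀f = let Af , hf = split A₀f in hf , φ⊆ Af
  injective₁ : ∀ {f g} → T (A₁ f) → T (A₁ g) → tail (φ f) ≡ tail (φ g) → f ≡ g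
  injective₁ A₁f A₁g eq = let Af , hf = split A₁f ; Ag , hg = split A₁g in
    injective Af Ag (head-tail⇒≡ (trans (Equivalence.to T-≡ hf) (sym (Equivalence.to T-≡ hg))) eq)
  injective₀ : ∀ {f g} → T (A₀ f) → T (A₀ g) → tail (φ f) ≡ tail (φ g) → f ≡ g
  injective₀ A₀f A₀g eq = let Af , hf = split A₀f ; Ag , hg = split A₀g in
    injective Af Ag (head-tail⇒≡ (trans (Equivalence.to T-not-≡ hf) (sym (Equivalence.to T-not-≡ hg))) eq)
  split-≤ : ∀ b c → (∀ {f} → T (A₁ f) → T (head (φ f)) × φ f ⊆[ c ] b ∷ q) →
                    (∀ {f} → T (A₀ f) → T (not (head (φ f))) × φ f ⊆[ c ] b ∷ q) →
                    count A₁ + count A₀ ≤ ∣ b ∷ q ∣ C c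
  split-≤ outside c φ⊆₁ φ⊆₀ = begin
    count A₁ + count A₀
      ≡⟨ cong (_+ count A₀) (count-≡-0 {p = A₁} λ _ → uncurry head∈⇒⊈[]outside ∘ φ⊆₁) ⟩
    count A₀
      ≤⟨ injective-family-≤-C q c A₀ (tail ∘ φ) (uncurry head∉⇒tail-⊆[] ∘ φ⊆₀) injective₀ ⟩
    ∣ q ∣ C c ∎
  split-≤ inside zero φ⊆₁ φ⊆₀ = begin
    count A₁ + count A₀
      ≡⟨ cong (count A₁ +_) (count-≡-0 {p = A₀} λ _ → uncurry head∉⇒⊈[0]inside ∘ φ⊆₀) ⟩
    count A₁ + 0
      ≡⟨ +-identityʳ _ ⟩
    count A₁
      ≤⟨ injective-family-≤-C q 0 A₁ (tail ∘ φ) (uncurry head∈⇒tail-⊆[] ∘ φ⊆₁) injective₁ ⟩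
    1 ∎
  split-≤ inside (suc c) φ⊆₁ φ⊆₀ = begin
    count A₁ + count A₀
      ≤⟨ +-mono-≤ (injective-family-≤-C q (suc c) A₁ (tail ∘ φ) (uncurry head∈⇒tail-⊆[] ∘ φ⊆₁) injective₁)
                  (injective-family-≤-C q c A₀ (tail ∘ φ) (uncurry head∉⇒tail-⊆[pred] ∘ φ⊆₀) injective₀) ⟩
    ∣ q ∣ C suc c + ∣ q ∣ C c
      ≡⟨ +-comm (∣ q ∣ C suc c) _ ⟩
    ∣ q ∣ C c + ∣ q ∣ C suc c
      ≡⟨ nCk+nC[k+1]≡[n+1]C[k+1] ∣ q ∣ c ⟩
    suc ∣ q ∣ C suc c ∎

minimiser : ∀ {a} {A : Set a} (P : A → Set) (cost : A → ℕ) →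
            (∀ c → Dec (∃ λ x → P x × cost x ≤ c)) →
            ∃ P → ∃ λ x → P x × ∀ y → P y → cost x ≤ cost y
minimiser P cost bounded? (x , Px) = descend (cost x) (x , Px , ≤-refl)
  where
  descend : ∀ c → (∃ λ x → P x × cost x ≤ c) → ∃ λ x → P x × ∀ y → P y → cost x ≤ cost y
  descend zero    (x , Px , x≤0)   = x , Px , λ _ _ → ≤-trans x≤0 z≤n
  descend (suc c) (x , Px , x≤1+c) with bounded? c
  ... | yes cheaper = descend c cheaper
  ... | no none     = x , Px , λ y Py → ≤-trans x≤1+c (≰⇒> λ y≤c → none (y , Py , y≤c))

-- Degrees and codegrees in a hypergraph

module _ {m n} (E : Fin m → Subset n) where

  deg : Subset n → ℕ
  deg S = count λ f → ⌊ S ⊆? E f ⌋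

  Admissible : Fin m × Fin n × Fin n → Set
  Admissible (e , u , v) = u ∈ E e × v ∈ E e × u ≢ v

  codeg : Fin m × Fin n × Fin n → ℕ
  codeg (e , u , v) = deg (E e - u - v)

  admissible? : ∀ y → Dec (Admissible y)
  admissible? (e , u , v) = u ∈? E e ×-dec v ∈? E e ×-dec ¬? (u Finₚ.≟ v)

  admissible-≤? : ∀ c → Dec (∃ λ y → Admissible y × codeg y ≤ c)
  admissible-≤? c = map′ (λ (e , u , v , p) → (e , u , v) , p) (λ ((e , u , v) , p) → e , u , v , p)
    (Finₚ.any? λ e → Finₚ.any? λ u → Finₚ.any? λ v → admissible? (e , u , v) ×-dec codeg (e , u , v) ≤? c)

  1≤deg-edge : ∀ e → 1 ≤ deg (E e)
  1≤deg-edge e = 1≤count {p = λ f → ⌊ E e ⊆? E f ⌋} e (fromWitness {a? = E e ⊆? E e} ⊆-refl)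

  laterCount-∷-≤-codeg : ∀ {a} e {τ : Fin a → Fin m} → Injective _≡_ _≡_ τ → ∀ {u v} (us vs : Fin a → Fin n) →
                         laterCount (E ∘ (e Vector.∷ τ)) (u Vector.∷ us) (v Vector.∷ vs) zero ≤ codeg (e , u , v)
  laterCount-∷-≤-codeg {a} e {τ} τ-injective {u} {v} us vs = begin
    laterCount (E ∘ (e Vector.∷ τ)) (u Vector.∷ us) (v Vector.∷ vs) zero
      ≡⟨ ∣tabulate∣≡count (λ j → ⌊ zero {a} <? j ⌋ ∧ ⌊ E e - u - v ⊆? E ((e Vector.∷ τ) j) ⌋) ⟩
    count (λ j → ⌊ E e - u - v ⊆? E (τ j) ⌋)
      ≤⟨ ∑-injective-≤ (λ f → 𝟙 ⌊ E e - u - v ⊆? E f ⌋) τ-injective ⟩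
    deg (E e - u - v) ∎
    where open ≤-Reasoning

module _ {m n k} {E : Fin m → Subset n} (E-injective : Injective _≡_ _≡_ E)
         (E-uniform : ∀ e → ∣ E e ∣ ≡ k) where

  edge-minus-pair-⊆[2] : ∀ {f g a b} → a ∈ E f → b ∈ E f → a ≢ b → E f - a - b ⊆ E g →
                         E f - a - b ⊆[ 2 ] E g
  edge-minus-pair-⊆[2] {f} {g} {a} {b} a∈f b∈f a≢b ⊆g = ⊆g , +-cancelʳ-≡ ∣ E f - a - b ∣ _ 2 (begin
    ∣ E g ─ (E f - a - b) ∣ + ∣ E f - a - b ∣  ≡⟨ p⊆q⇒∣q─p∣+∣p∣≡∣q∣ ⊆g ⟩
    ∣ E g ∣                                  ≡⟨ trans (E-uniform g) (sym (E-uniform f)) ⟩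
    ∣ E f ∣                                  ≡⟨ 2+∣p-x-y∣≡∣p∣ a∈f b∈f a≢b ⟨
    2 + ∣ E f - a - b ∣                      ∎)
    where open ≡-Reasoning

  in-fibre : ∀ {S a b f g} → T (⌊ S ⊆? E f ⌋ ∧ ⌊ E f - a - b ⊆? E g ⌋) → S ⊆ E f × E f - a - b ⊆ E g
  in-fibre {S} {a} {b} {f} {g} = toWitness-∧ {P? = S ⊆? E f} {Q? = E f - a - b ⊆? E g}

  fibre-≤ : ∀ {S a b} → a ∈ S → b ∈ S → a ≢ b → ∀ g →
            count (λ f → ⌊ S ⊆? E f ⌋ ∧ ⌊ E f - a - b ⊆? E g ⌋) ≤ (k C 2) * 𝟙 ⌊ S - a - b ⊆? E g ⌋
  fibre-≤ {S} {a} {b} a∈S b∈S a≢b g with S - a - b ⊆? E g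
  ... | yes _ = begin
    count (λ f → ⌊ S ⊆? E f ⌋ ∧ ⌊ E f - a - b ⊆? E g ⌋)
      ≤⟨ injective-family-≤-C (E g) 2 _ (λ f → E f - a - b) φ⊆ φ-injective ⟩
    ∣ E g ∣ C 2  ≡⟨ cong (_C 2) (E-uniform g) ⟩
    k C 2        ≡⟨ *-identityʳ _ ⟨
    (k C 2) * 1  ∎
    where
    open ≤-Reasoning
    φ⊆ : ∀ {f} → T (⌊ S ⊆? E f ⌋ ∧ ⌊ E f - a - b ⊆? E g ⌋) → E f - a - b ⊆[ 2 ] E g
    φ⊆ x = let S⊆f , ⊆g = in-fibre x in edge-minus-pair-⊆[2] (S⊆f a∈S) (S⊆f b∈S) a≢b ⊆g
    φ-injective : ∀ {f f′} → T (⌊ S ⊆? E f ⌋ ∧ ⌊ E f - a - b ⊆? E g ⌋) →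
                  T (⌊ S ⊆? E f′ ⌋ ∧ ⌊ E f′ - a - b ⊆? E g ⌋) → E f - a - b ≡ E f′ - a - b → f ≡ f′
    φ-injective x x′ eq = let S⊆f , _ = in-fibre x ; S⊆f′ , _ = in-fibre x′ in
      E-injective (p-x-y≡q-x-y⇒p≡q (S⊆f a∈S) (S⊆f b∈S) (S⊆f′ a∈S) (S⊆f′ b∈S) eq)
  ... | no S-a-b⊈g = ≤-reflexive (trans
          (count-≡-0 {p = λ f → ⌊ S ⊆? E f ⌋ ∧ ⌊ E f - a - b ⊆? E g ⌋} λ f x →
            let S⊆f , ⊆g = in-fibre x in S-a-b⊈g (⊆g ∘ p⊆q⇒p-x⊆q-x (p⊆q⇒p-x⊆q-x S⊆f)))
          (sym (*-zeroʳ (k C 2))))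

  deg-step : ∀ {Γ} → (∀ y → Admissible E y → Γ ≤ codeg E y) →
             ∀ {S a b} → a ∈ S → b ∈ S → a ≢ b → Γ * deg E S ≤ (k C 2) * deg E (S - a - b)
  deg-step {Γ} Γ-minimal {S} {a} {b} a∈S b∈S a≢b = begin
    Γ * deg E S
      ≡⟨ *-comm Γ _ ⟩
    deg E S * Γ
      ≡⟨ *-distribʳ-sum Γ (λ f → 𝟙 (x f)) ⟩
    ∑[ f < m ] (𝟙 (x f) * Γ)
      ≤⟨ ∑-mono-≤ (λ f → 𝟙-*-mono-≤ (x f) λ S⊆f →
           Γ-minimal (f , a , b) (toWitness S⊆f a∈S , toWitness S⊆f b∈S , a≢b)) ⟩
    ∑[ f < m ] (𝟙 (x f) * deg E (E f - a - b))
      ≡⟨ sum-cong-≗ (λ f → *-distribˡ-sum (𝟙 (x f)) (λ g → 𝟙 (y f g))) ⟩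
    ∑[ f < m ] ∑[ g < m ] (𝟙 (x f) * 𝟙 (y f g))
      ≡⟨ ∑-comm (λ f g → 𝟙 (x f) * 𝟙 (y f g)) ⟩
    ∑[ g < m ] ∑[ f < m ] (𝟙 (x f) * 𝟙 (y f g))
      ≡⟨ sum-cong-≗ (λ g → sum-cong-≗ (λ f → 𝟙-∧ (x f) (y f g))) ⟩
    ∑[ g < m ] count (λ f → x f ∧ y f g)
      ≤⟨ ∑-mono-≤ (fibre-≤ a∈S b∈S a≢b) ⟩
    ∑[ g < m ] ((k C 2) * 𝟙 ⌊ S - a - b ⊆? E g ⌋)
      ≡⟨ *-distribˡ-sum (k C 2) (λ g → 𝟙 ⌊ S - a - b ⊆? E g ⌋) ⟨
    (k C 2) * deg E (S - a - b) ∎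
    where
    open ≤-Reasoning
    x : Fin m → Bool
    x f = ⌊ S ⊆? E f ⌋
    y : Fin m → Fin m → Bool
    y f g = ⌊ E f - a - b ⊆? E g ⌋

  deg-step-iterated : ∀ {Γ} → (∀ y → Admissible E y → Γ ≤ codeg E y) →
                      ∀ j {S} → 2 * j ≤ ∣ S ∣ → Γ ^ j * deg E S ≤ (k C 2) ^ j * m
  deg-step-iterated Γ-minimal zero {S} _ = begin
    1 * deg E S  ≡⟨ *-identityˡ (deg E S) ⟩
    deg E S      ≤⟨ count-≤ _ ⟩
    m            ≡⟨ *-identityˡ m ⟨
    1 * m        ∎
    where open ≤-Reasoning
  deg-step-iterated {Γ} Γ-minimal (suc j) {S} 2+2j≤∣S∣
    with a , b , a∈S , b∈S , a≢b ← ∣p∣≥2⇒two-elements S (≤-trans (*-monoʳ-≤ 2 (s≤s z≤n)) 2+2j≤∣S∣)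
    = begin
    Γ * Γ ^ j * deg E S             ≡⟨ xy∙z≈y∙xz Γ (Γ ^ j) (deg E S) ⟩
    Γ ^ j * (Γ * deg E S)           ≤⟨ *-monoʳ-≤ (Γ ^ j) (deg-step Γ-minimal a∈S b∈S a≢b) ⟩
    Γ ^ j * ((k C 2) * deg E S′)    ≡⟨ x∙yz≈y∙xz (Γ ^ j) (k C 2) (deg E S′) ⟩
    (k C 2) * (Γ ^ j * deg E S′)    ≤⟨ *-monoʳ-≤ (k C 2) (deg-step-iterated Γ-minimal j 2j≤∣S′∣) ⟩
    (k C 2) * ((k C 2) ^ j * m)     ≡⟨ *-assoc (k C 2) ((k C 2) ^ j) m ⟨
    (k C 2) * (k C 2) ^ j * m       ∎
    where
    open ≤-Reasoning
    S′ = S - a - b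
    2j≤∣S′∣ : 2 * j ≤ ∣ S′ ∣
    2j≤∣S′∣ = +-cancelˡ-≤ 2 _ _ (subst₂ _≤_ (*-suc 2 j) (sym (2+∣p-x-y∣≡∣p∣ a∈S b∈S a≢b)) 2+2j≤∣S∣)

  low-codegree-pair : 2 ≤ k → Fin m → ∃ λ y → Admissible E y × codeg E y ^ (k / 2) ≤ (k C 2) ^ (k / 2) * m
  low-codegree-pair 2≤k e₀
    with u₀ , v₀ , u₀∈ , v₀∈ , u₀≢v₀ ← ∣p∣≥2⇒two-elements (E e₀) (subst (2 ≤_) (sym (E-uniform e₀)) 2≤k)
    with y@(e , _) , y-admissible , y-minimal
           ← minimiser (Admissible E) (codeg E) (admissible-≤? E) ((e₀ , u₀ , v₀) , u₀∈ , v₀∈ , u₀≢v₀)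
    = y , y-admissible , (begin
    codeg E y ^ t               ≡⟨ *-identityʳ (codeg E y ^ t) ⟨
    codeg E y ^ t * 1           ≤⟨ *-monoʳ-≤ (codeg E y ^ t) (1≤deg-edge E e) ⟩
    codeg E y ^ t * deg E (E e) ≤⟨ deg-step-iterated y-minimal t 2t≤∣Eₑ∣ ⟩
    (k C 2) ^ t * m             ∎)
    where
    open ≤-Reasoning
    t = k / 2
    2t≤∣Eₑ∣ : 2 * t ≤ ∣ E e ∣
    2t≤∣Eₑ∣ = subst₂ _≤_ (*-comm t 2) (sym (E-uniform e)) (m/n*n≤m k 2)

-- The greedy ordering

-- Not refl: ⌊_⌋ is stuck on the neutral comparison of toℕ i and toℕ j.
laterCount-suc : ∀ {m n} (e : Fin (suc m) → Subset n) (u v : Fin (suc m) → Fin n) i →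
                 laterCount e u v (suc i) ≡ laterCount (e ∘ suc) (u ∘ suc) (v ∘ suc) i
laterCount-suc e u v i = begin
  laterCount e u v (suc i)
    ≡⟨ ∣tabulate∣≡count (λ j → ⌊ suc i <? j ⌋ ∧ ⌊ X ⊆? e j ⌋) ⟩
  count (λ j → ⌊ suc i <? suc j ⌋ ∧ ⌊ X ⊆? e (suc j) ⌋)
    ≡⟨ sum-cong-≗ (λ j → cong (λ b → 𝟙 (b ∧ ⌊ X ⊆? e (suc j) ⌋)) (⌊suc<?suc⌋ i j)) ⟩
  count (λ j → ⌊ i <? j ⌋ ∧ ⌊ X ⊆? e (suc j) ⌋)
    ≡⟨ ∣tabulate∣≡count (λ j → ⌊ i <? j ⌋ ∧ ⌊ X ⊆? e (suc j) ⌋) ⟨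
  laterCount (e ∘ suc) (u ∘ suc) (v ∘ suc) i ∎
  where
  open ≡-Reasoning
  X = e (suc i) - u (suc i) - v (suc i)
  ⌊suc<?suc⌋ : ∀ {m} (i j : Fin m) → ⌊ suc i <? suc j ⌋ ≡ ⌊ i <? j ⌋
  ⌊suc<?suc⌋ i j = trans (isYes≗does (suc i <? suc j))
    (trans (does-⇔ (mk⇔ s<s⁻¹ s<s) (suc i <? suc j) (i <? j)) (sym (isYes≗does (i <? j))))

∷-punchIn-injective : ∀ {a b} (i : Fin (suc b)) {σ : Fin a → Fin b} → Injective _≡_ _≡_ σ →
                      Injective _≡_ _≡_ (i Vector.∷ punchIn i ∘ σ)
∷-punchIn-injective i σ-injective {zero}  {zero}  _  = refl
∷-punchIn-injective i {σ} _       {zero}  {suc y} eq = contradiction (sym eq) (punchInᵢ≢i i (σ y))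
∷-punchIn-injective i {σ} _       {suc x} {zero}  eq = contradiction eq (punchInᵢ≢i i (σ x))
∷-punchIn-injective i σ-injective {suc x} {suc y} eq = cong suc (σ-injective (punchIn-injective i _ _ eq))

BoundedOrdering : ∀ {m n} → ℕ → (Fin m → Subset n) → ℕ → Set
BoundedOrdering {m} {n} t E B =
  Σ (Fin m → Fin m) λ σ → Injective _≡_ _≡_ σ
  × Σ (Fin m → Fin n) λ u → Σ (Fin m → Fin n) λ v →
      (∀ i → u i ∈ E (σ i)) × (∀ i → v i ∈ E (σ i)) × (∀ i → u i ≢ v i)
      × (∀ i → laterCount (E ∘ σ) u v i ^ t ≤ B)

boundedOrdering-mono : ∀ {m n t B B′} {E : Fin m → Subset n} →
                       B ≤ B′ → BoundedOrdering t E B → BoundedOrdering t E B′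
boundedOrdering-mono B≤B′ (σ , σ-injective , u , v , u∈ , v∈ , u≢v , bound) =
  σ , σ-injective , u , v , u∈ , v∈ , u≢v , λ i → ≤-trans (bound i) B≤B′

boundedOrdering-∷ : ∀ {m n t B} {E : Fin (suc m) → Subset n} e {u v} → u ∈ E e → v ∈ E e → u ≢ v →
                    codeg E (e , u , v) ^ t ≤ B → BoundedOrdering t (E ∘ punchIn e) B → BoundedOrdering t E B
boundedOrdering-∷ {t = t} {B} {E} e {u} {v} u∈e v∈e u≢v first-bound
                  (σ , σ-injective , us , vs , us∈ , vs∈ , us≢vs , rest-bound) =
  e Vector.∷ punchIn e ∘ σ , ∷-punchIn-injective e σ-injective , u Vector.∷ us , v Vector.∷ vs
  , (λ { zero → u∈e ; (suc i) → us∈ i })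
  , (λ { zero → v∈e ; (suc i) → vs∈ i })
  , (λ { zero → u≢v ; (suc i) → us≢vs i })
  , bound
  where
  bound : ∀ i → laterCount (E ∘ (e Vector.∷ punchIn e ∘ σ)) (u Vector.∷ us) (v Vector.∷ vs) i ^ t ≤ B
  bound zero = ≤-trans (^-monoˡ-≤ t (laterCount-∷-≤-codeg E e (σ-injective ∘ punchIn-injective e _ _) us vs))
                       first-bound
  bound (suc i) = subst (λ c → c ^ t ≤ B)
                        (sym (laterCount-suc (E ∘ (e Vector.∷ punchIn e ∘ σ)) (u Vector.∷ us) (v Vector.∷ vs) i))
                        (rest-bound i)

lemma7p5 : (k n m : ℕ) → 2 ≤ k
    → (E : Fin m → Subset n) → Injective _≡_ _≡_ E → (∀ x → ∣ E x ∣ ≡ k)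
    → Σ (Fin m → Fin m) λ σ → Injective _≡_ _≡_ σ
      × Σ (Fin m → Fin n) λ u → Σ (Fin m → Fin n) λ v →
          (∀ i → u i ∈ E (σ i)) × (∀ i → v i ∈ E (σ i)) × (∀ i → u i ≢ v i)
          × (∀ i → laterCount (E ∘ σ) u v i ^ (k / 2) ≤ (k C 2) ^ (k / 2) * m)
lemma7p5 k n zero _ _ _ _ = (λ ()) , (λ { {()} }) , (λ ()) , (λ ()) , (λ ()) , (λ ()) , (λ ()) , (λ ())
lemma7p5 k n (suc m) 2≤k E E-injective E-uniform = prepend (low-codegree-pair E-injective E-uniform 2≤k zero)
  where
  prepend : ∃ (λ y → Admissible E y × codeg E y ^ (k / 2) ≤ (k C 2) ^ (k / 2) * suc m) →
            BoundedOrdering (k / 2) E ((k C 2) ^ (k / 2) * suc m)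
  prepend ((e , u , v) , (u∈e , v∈e , u≢v) , first-bound) =
    boundedOrdering-∷ {t = k / 2} e u∈e v∈e u≢v first-bound
      (boundedOrdering-mono {t = k / 2} {E = E ∘ punchIn e} (*-monoʳ-≤ ((k C 2) ^ (k / 2)) (n≤1+n m))
        (lemma7p5 k n m 2≤k (E ∘ punchIn e) (punchIn-injective e _ _ ∘ E-injective) (E-uniform ∘ punchIn e)))
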